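{- Let $m_1,m_2\in\mathbb{Q}$ be such that $m_1-m_2=P/Q$ with $\gcd(P,Q)=1$ and $Q\ge6$, and with $k_0:=6(m_1+m_2)-1\in\mathbb{Z}$. Put \[a=\tfrac1{12}+\tfrac{m_1-m_2}{2},\quad b=\tfrac1{12}-\tfrac{m_1-m_2}{2},\quad c=\tfrac23,\] \[f_1=\eta^{2k_0}J^{ -a}F(a,1+a-c;1+a-b;J^{ -1}),\qquad f_2=\eta^{2k_0}J^{ -b}F(b,1+b-c;1+b-a;J^{ -1}).\] Then one of the following holds: (a) $m_1>m_2$ and for every prime $p$ of the form $Qn+P$ ($n\ge1$) there is at least one Fourier coefficient of $f_1$ that has $p$-adic valuation $-1$; (b) $m_2>m_1$ and for every prime $p$ of the form $Qn-P$ ($n\ge1$) there is at least one Fourier coefficient of $f_2$ that has $p$-adic valuation $-1$.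
   Context: $q=e^{2\pi i\tau}$; $\eta(q)=q^{1/24}\prod_{n\ge1}(1-q^n)$; $j=q^{ -1}+744+\dots$ is the absolute modular invariant and $J=j/1728$, so $J^{ -a}=1728^{a}j^{ -a}$ with $j^{ -a}=q^{a}(1+744q+\cdots)^{ -a}$ expanded as a formal power series; $F(a,b;c;z)=1+\sum_{n\ge1}\frac{(a)_n(b)_n}{(c)_n(1)_n}z^n$ is Gauss's hypergeometric function. The Fourier coefficients of $f_1$ (resp. $f_2$) are $1728^{a}$ (resp. $1728^{b}$) times rational numbers, and $p$-adic valuations are taken with respect to any extension of the $p$-adic valuation (normalized with $v_p(p)=1$) to the field generated by these constants. -}

module Defs where

open import Data.Nat as ℕ using (ℕ; zero; suc; NonZero)
open import Data.Nat.DivMod using (_%_; _/_)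
open import Data.Nat.Divisibility using (_∣?_)
open import Data.Integer as ℤ using (ℤ; +_; ∣_∣)
open import Data.Rational as ℚ using (ℚ; 0ℚ; 1ℚ; ↥_; ↧ₙ_; _+_; _*_; _-_; -_)
open import Data.Rational.Properties using (_≟_)
open import Relation.Nullary using (yes; no)

-- formal power series in q with rational coefficients: n ↦ coefficient of q^n
Series : Set
Series = ℕ → ℚ

ℤ→ℚ : ℤ → ℚ
ℤ→ℚ z = ℚ._/_ z 1

ℕ→ℚ : ℕ → ℚ
ℕ→ℚ n = ℤ→ℚ (+ n)

-- total division (x / 0 := 0); only ever used with nonzero divisors
divℚ : ℚ → ℚ → ℚ
divℚ x y with y ≟ 0ℚ
... | yes _ = 0ℚ
... | no y≢0 = ℚ._÷_ x y {{ℚ.≢-nonZero y≢0}}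

sumTo : ℕ → (ℕ → ℚ) → ℚ
sumTo zero f = f 0
sumTo (suc n) f = sumTo n f + f (suc n)

oneS : Series
oneS zero = 1ℚ
oneS (suc n) = 0ℚ

mulS : Series → Series → Series
mulS f g n = sumTo n (λ i → f i * g (n ℕ.∸ i))

npowS : Series → ℕ → Series
npowS f zero = oneS
npowS f (suc k) = mulS f (npowS f k)

gbinom : ℚ → ℕ → ℚ
gbinom r zero = 1ℚ
gbinom r (suc k) = gbinom r k * (r - ℕ→ℚ k) * ℚ._/_ (+ 1) (suc k)

-- s^r := Σ_k binom(r,k) (s-1)^k  for a series s with constant term 1
-- (for integer r this is the usual power)
powS : ℚ → Series → Series
powS r s n = sumTo n (λ k → gbinom r k * npowS (λ i → s i - oneS i) k n)

oneMinusQ : ℕ → Series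
oneMinusQ m i with i ℕ.≟ 0 | i ℕ.≟ m
... | yes _ | _ = 1ℚ
... | no _ | yes _ = - 1ℚ
... | no _ | no _ = 0ℚ

finEuler : ℕ → Series
finEuler zero = oneS
finEuler (suc N) = mulS (finEuler N) (oneMinusQ (suc N))

-- Euler product ∏_{m≥1} (1-q^m)  (so η = q^{1/24} · eulerS)
eulerS : Series
eulerS n = finEuler n n

sigma3 : ℕ → ℕ
sigma3 n = go n
  where
  go : ℕ → ℕ
  go zero = 0
  go (suc d) with suc d ∣? n
  ... | yes _ = suc d ℕ.* suc d ℕ.* suc d ℕ.+ go d
  ... | no _ = go d

E4S : Series
E4S zero = 1ℚ
E4S (suc n) = ℕ→ℚ (240 ℕ.* sigma3 (suc n))

-- j = E₄³/Δ with Δ = q ∏(1-q^n)^24, so j⁻¹ = q · jInvTilde,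
-- jInvTilde = ∏(1-q^n)^24 · E₄^{-3}  (constant term 1)
jInvTilde : Series
jInvTilde = mulS (powS (ℕ→ℚ 24) eulerS) (powS (- ℕ→ℚ 3) E4S)

-- J⁻¹ = 1728/j = 1728 q jInvTilde
JinvS : Series
JinvS zero = 0ℚ
JinvS (suc n) = ℕ→ℚ 1728 * jInvTilde n

-- hypergeometric coefficients (A)_n (B)_n / ((C)_n n!)
hypCoeff : ℚ → ℚ → ℚ → ℕ → ℚ
hypCoeff A B C zero = 1ℚ
hypCoeff A B C (suc n) =
  divℚ (hypCoeff A B C n * (A + ℕ→ℚ n) * (B + ℕ→ℚ n))
       ((C + ℕ→ℚ n) * ℕ→ℚ (suc n))

-- F(A,B;C;Z(q)) for a series Z with zero constant term
hypComp : ℚ → ℚ → ℚ → Series → Series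
hypComp A B C Z n = sumTo n (λ k → hypCoeff A B C k * npowS Z k n)

-- For η^{2k₀} J^{-α} F(α,β;γ;J⁻¹) the q-expansion is
--   1728^α · q^{k₀/12 + α} · Σ_n (modFormSeries k₀ α β γ n) qⁿ ,
-- i.e. the Fourier coefficients are 1728^α · modFormSeries k₀ α β γ n.
modFormSeries : ℤ → ℚ → ℚ → ℚ → Series
modFormSeries k₀ α β γ =
  mulS (powS (ℤ→ℚ (ℤ._*_ (+ 2) k₀)) eulerS)
       (mulS (powS α jInvTilde) (hypComp α β γ JinvS))

-- p-adic valuation of a natural number (0 for p ≤ 1; value at 0 irrelevant)
vpAux : ℕ → (p : ℕ) → .{{NonZero p}} → ℕ → ℕ
vpAux zero p n = 0
vpAux (suc f) p n with n % p ℕ.≟ 0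
... | yes _ = suc (vpAux f p (n / p))
... | no _ = 0

vpℕ : ℕ → ℕ → ℕ
vpℕ zero n = 0
vpℕ (suc zero) n = 0
vpℕ (suc (suc k)) n = vpAux n (suc (suc k)) n

vpℚ : ℕ → ℚ → ℤ
vpℚ p r = ℤ._-_ (+ vpℕ p ∣ ↥ r ∣) (+ vpℕ p (↧ₙ r))

-- p-adic valuation of the constant-times-rational 1728^α · r (r ≠ 0):
--   α · v_p(1728) + v_p(r)
vpScaled : ℕ → ℚ → ℚ → ℚ
vpScaled p α r = α * ℕ→ℚ (vpℕ p 1728) + ℤ→ℚ (vpℚ p r)

module Submission where

-- Write m₁ - m₂ = P/Q; P ≠ 0 since gcd(P,Q) = 1 and Q ≥ 6.  Let R = |P| and δ = R/Q, so
-- that δ = m₁ - m₂ in case (a) and δ = m₂ - m₁ in case (b), the parameters of the relevant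
-- series being, in both cases,
--   A = 1/12 + δ/2,  B = 1 + A - 2/3 = 5/12 + δ/2,  C = 1 + δ.
-- For a prime p = Q(m+1) + R the numbers A + j, B + j (j ≤ m), C + j (j < m) and j + 1
-- (j ≤ m) are p-units, while C + m = p/Q has valuation 1.  Hence the hypergeometric
-- coefficients (A)_k (B)_k / ((C)_k k!) are p-units for k ≤ m and the (m+1)-st has valuation
-- -1.  Every other ingredient of the coefficient of index m+1 (powers of the Euler product,
-- of j⁻¹ and binomial coefficients with index < p) is p-integral, and the leading
-- coefficient 1728^(m+1) of (J⁻¹)^(m+1) is a p-unit, so that coefficient has valuation -1.

open import Defs
open import Data.Nat as ℕ using (ℕ; zero; suc; z≤n; s≤s; NonZero)
import Data.Nat.Properties as ℕP
open import Data.Nat.Divisibility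
  using (_∣_; divides; _∣0; ∣⇒≤; ∣1⇒≡1; ∣-refl; ∣m⇒∣m*n; ∣n⇒∣m*n; m∣m*n; ∣m+n∣m⇒∣n;
         quotient; m∣n⇒n≡m*quotient; m%n≡0⇒n∣m; n∣m⇒m%n≡0)
open import Data.Nat.Coprimality as Coprimality using (Coprime; coprime?)
open import Data.Nat.Primality using (Prime; euclidsLemma; prime⇒nonZero; prime⇒nonTrivial)
open import Data.Nat.Tactic.RingSolver using (solve-∀)
open import Data.Integer as ℤ using (ℤ; +_; -[1+_]; +[1+_])
import Data.Integer.Properties as ℤP
import Data.Integer.Divisibility.Signed as ℤDiv
open import Data.Rational as ℚ using (ℚ; mkℚ; toℚᵘ; 0ℚ; 1ℚ; ↥_; ↧ₙ_)
import Data.Rational.Properties as ℚP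
import Data.Rational.Unnormalised as U
import Data.Rational.Unnormalised.Properties as UP
open import Data.Product using (Σ; ∃; _×_; _,_)
open import Data.Sum using (_⊎_; inj₁; inj₂; [_,_])
open import Data.Empty using (⊥; ⊥-elim)
open import Relation.Nullary using (¬_; yes; no)
open import Relation.Nullary.Decidable using (recompute)
open import Relation.Binary.PropositionalEquality hiding ([_])

module PrimeDivisibility (p : ℕ) (p-prime : Prime p) where
  open import Data.Nat using (_*_; _<_)

  1<p : 1 < p
  1<p = ℕ.nonTrivial⇒n>1 p {{prime⇒nonTrivial p-prime}}

  instance
    p-nonZero : NonZero p
    p-nonZero = prime⇒nonZero p-prime

  p∤1 : ¬ p ∣ 1
  p∤1 p∣1 = ℕP.<-irrefl (sym (∣1⇒≡1 p∣1)) 1<p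

  p∤-small : ∀ {m} → 0 < m → m < p → ¬ p ∣ m
  p∤-small {suc m} _ m<p p∣m = ℕP.<⇒≱ m<p (∣⇒≤ p∣m)

  p∤-* : ∀ {m n} → ¬ p ∣ m → ¬ p ∣ n → ¬ p ∣ m * n
  p∤-* {m} {n} p∤m p∤n p∣mn = [ p∤m , p∤n ] (euclidsLemma m n p-prime p∣mn)

  p∤-both : ∀ {N D} → Coprime N D → p ∣ N → p ∣ D → ⊥
  p∤-both coprime p∣N p∣D = ℕP.<-irrefl (sym (coprime (p∣N , p∣D))) 1<p

  -- In the next three lemmas N/D is reduced and N/D = A/E, i.e. N * E ≡ A * D.

  reduced-den : ∀ {N D A E} → Coprime N D → N * E ≡ A * D → ¬ p ∣ E → ¬ p ∣ D
  reduced-den {N} {D} {A} {E} coprime cross p∤E p∣D =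
    [ (λ p∣N → p∤-both coprime p∣N p∣D) , p∤E ]
      (euclidsLemma N E p-prime (subst (p ∣_) (sym cross) (∣n⇒∣m*n A p∣D)))

  reduced-num : ∀ {N D A E} → N * E ≡ A * D → ¬ p ∣ A → ¬ p ∣ D → ¬ p ∣ N
  reduced-num {N} {D} {A} {E} cross p∤A p∤D p∣N =
    p∤-* p∤A p∤D (subst (p ∣_) cross (∣m⇒∣m*n E p∣N))

  reduced-simple : ∀ {N D A E} → Coprime N D → N * E ≡ A * D →
                   (e : ℕ) → E ≡ p * e → ¬ p ∣ e → ¬ p ∣ A →
                   Σ ℕ λ e' → D ≡ p * e' × ¬ p ∣ e' × ¬ p ∣ N
  reduced-simple {N} {D} {A} {E} coprime cross e E≡pe p∤e p∤A = e' , D≡pe' , p∤e' , p∤N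
    where
    p∣D : p ∣ D
    p∣D = [ (λ p∣A → ⊥-elim (p∤A p∣A)) , (λ p∣D → p∣D) ]
            (euclidsLemma A D p-prime (subst (p ∣_) cross (∣n⇒∣m*n N (subst (p ∣_) (sym E≡pe) (m∣m*n e)))))
    e' : ℕ
    e' = quotient p∣D
    D≡pe' : D ≡ p * e'
    D≡pe' = m∣n⇒n≡m*quotient p∣D
    p∤N : ¬ p ∣ N
    p∤N p∣N = p∤-both coprime p∣N p∣D
    exchange : ∀ x y z → x * (y * z) ≡ y * (x * z)
    exchange = solve-∀
    cancelled : N * e ≡ A * e'
    cancelled = ℕP.*-cancelˡ-≡ (N * e) (A * e') p (begin
      p * (N * e)  ≡⟨ exchange p N e ⟩
      N * (p * e)  ≡⟨ cong (N *_) (sym E≡pe) ⟩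
      N * E        ≡⟨ cross ⟩
      A * D        ≡⟨ cong (A *_) D≡pe' ⟩
      A * (p * e') ≡⟨ exchange A p e' ⟩
      p * (A * e') ∎)
      where open ≡-Reasoning
    p∤e' : ¬ p ∣ e'
    p∤e' p∣e' = p∤-* p∤N p∤e (subst (p ∣_) (sym cancelled) (∣n⇒∣m*n A p∣e'))

module NatValuation where
  open import Data.Nat using (_*_; _<_)
  open import Data.Nat.DivMod using (_%_; _/_; m*n/n≡m)

  vpAux-coprime : ∀ fuel q .{{_ : NonZero q}} n → ¬ q ∣ n → vpAux (suc fuel) q n ≡ 0
  vpAux-coprime fuel q n q∤n with n % q ℕ.≟ 0
  ... | yes n%q≡0 = ⊥-elim (q∤n (m%n≡0⇒n∣m n q n%q≡0))
  ... | no _ = refl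

  vpℕ-coprime : ∀ q n → 1 < q → ¬ q ∣ n → vpℕ q n ≡ 0
  vpℕ-coprime (suc zero) _ (s≤s ()) _
  vpℕ-coprime (suc (suc k)) zero _ _ = refl
  vpℕ-coprime (suc (suc k)) (suc n) _ q∤n = vpAux-coprime n (suc (suc k)) (suc n) q∤n

  vpℕ-simple : ∀ q n e → 1 < q → n ≡ q * e → ¬ q ∣ e → vpℕ q n ≡ 1
  vpℕ-simple (suc zero) _ _ (s≤s ()) _ _
  vpℕ-simple (suc (suc k)) zero e _ 0≡qe q∤e with ℕP.m*n≡0⇒m≡0∨n≡0 (suc (suc k)) {e} (sym 0≡qe)
  ... | inj₂ refl = ⊥-elim (q∤e (_ ∣0))
  vpℕ-simple q@(suc (suc k)) (suc n) e _ n≡qe q∤e with suc n % q ℕ.≟ 0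
  ... | no q∤n = ⊥-elim (q∤n (n∣m⇒m%n≡0 (suc n) q (divides e (trans n≡qe (ℕP.*-comm q e)))))
  ... | yes _ = cong suc (trans (cong (vpAux n q) n/q≡e) (remaining n n≡qe))
    where
    n/q≡e : suc n / q ≡ e
    n/q≡e = trans (cong (_/ q) (trans n≡qe (ℕP.*-comm q e))) (m*n/n≡m e q)
    -- after one division the remainder is nonzero; this needs at least one unit of fuel
    remaining : ∀ fuel → suc fuel ≡ q * e → vpAux fuel q e ≡ 0
    remaining zero 1≡qe = ⊥-elim (ℕP.<⇒≱ (s≤s (s≤s z≤n)) (∣⇒≤ (divides e (trans 1≡qe (ℕP.*-comm q e)))))
    remaining (suc fuel) _ = vpAux-coprime fuel q e q∤e

-- Rationals classified by their p-adic valuation: integral (v ≥ 0), units (v = 0),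
-- simple poles (v = -1) and simple zeros (v = 1), read off the reduced fraction.
module LocalRationals (p : ℕ) (p-prime : Prime p) where
  open import Data.Nat using (_*_; _<_)
  open PrimeDivisibility p p-prime public
  open NatValuation

  num : ℚ → ℕ
  num r = ℤ.∣ ↥ r ∣

  numᵘ : U.ℚᵘ → ℕ
  numᵘ u = ℤ.∣ U.↥ u ∣

  record Integral (r : ℚ) : Set where
    constructor integral
    field den-coprime : ¬ p ∣ ↧ₙ r

  record Unit (r : ℚ) : Set where
    constructor unit
    field num-coprime : ¬ p ∣ num r
          den-coprime : ¬ p ∣ ↧ₙ r

  record SimplePole (r : ℚ) : Set where
    constructor simplePole
    field cofactor : ℕ
          den≡p*cofactor : ↧ₙ r ≡ p * cofactor
          cofactor-coprime : ¬ p ∣ cofactor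
          num-coprime : ¬ p ∣ num r

  record SimpleZero (r : ℚ) : Set where
    constructor simpleZero
    field cofactor : ℕ
          num≡p*cofactor : num r ≡ p * cofactor
          cofactor-coprime : ¬ p ∣ cofactor
          den-coprime : ¬ p ∣ ↧ₙ r

  unit⇒integral : ∀ {r} → Unit r → Integral r
  unit⇒integral (unit _ p∤d) = integral p∤d

  reduced : ∀ r → Coprime (num r) (↧ₙ r)
  reduced (mkℚ n d coprime) = recompute (coprime? _ _) coprime

  cross : ∀ r u → toℚᵘ r U.≃ u → num r * U.↧ₙ u ≡ numᵘ u * ↧ₙ r
  cross (mkℚ n d _) u (U.*≡* eq) =
    trans (sym (ℤP.abs-* n (U.↧ u))) (trans (cong ℤ.∣_∣ eq) (ℤP.abs-* (U.↥ u) (+ suc d)))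

  integral-via : ∀ {r u} → toℚᵘ r U.≃ u → ¬ p ∣ U.↧ₙ u → Integral r
  integral-via {r} {u} r≃u p∤d = integral (reduced-den {A = numᵘ u} (reduced r) (cross r u r≃u) p∤d)

  unit-via : ∀ {r u} → toℚᵘ r U.≃ u → ¬ p ∣ numᵘ u → ¬ p ∣ U.↧ₙ u → Unit r
  unit-via {r} {u} r≃u p∤n p∤d = unit (reduced-num {A = numᵘ u} (cross r u r≃u) p∤n p∤D) p∤D
    where p∤D = Integral.den-coprime (integral-via {r} {u} r≃u p∤d)

  simplePole-via : ∀ {r u} → toℚᵘ r U.≃ u → (e : ℕ) → U.↧ₙ u ≡ p * e → ¬ p ∣ e → ¬ p ∣ numᵘ u →
                   SimplePole r
  simplePole-via {r} {u} r≃u e d≡pe p∤e p∤n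
    with reduced-simple (reduced r) (cross r u r≃u) e d≡pe p∤e p∤n
  ... | e' , D≡pe' , p∤e' , p∤N = simplePole e' D≡pe' p∤e' p∤N

  simpleZero-via : ∀ {r u} → toℚᵘ r U.≃ u → (e : ℕ) → numᵘ u ≡ p * e → ¬ p ∣ e → ¬ p ∣ U.↧ₙ u →
                   SimpleZero r
  simpleZero-via {r} {u} r≃u e n≡pe p∤e p∤d
    with reduced-simple (Coprimality.sym (reduced r)) swapped e n≡pe p∤e p∤d
    where
    swapped : ↧ₙ r * numᵘ u ≡ U.↧ₙ u * num r
    swapped = trans (ℕP.*-comm (↧ₙ r) (numᵘ u))
                (trans (sym (cross r u r≃u)) (ℕP.*-comm (num r) (U.↧ₙ u)))
  ... | e' , N≡pe' , p∤e' , p∤D = simpleZero e' N≡pe' p∤e' p∤D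

  p∤-+ : ∀ (A B : ℤ) → ¬ p ∣ ℤ.∣ A ∣ → p ∣ ℤ.∣ B ∣ → ¬ p ∣ ℤ.∣ A ℤ.+ B ∣
  p∤-+ A B p∤A p∣B p∣A+B = p∤A (ℤDiv.∣⇒∣ᵤ {+ p} {A}
    (ℤDiv.∣m+n∣n⇒∣m {+ p} {A} {B} (ℤDiv.∣ᵤ⇒∣ {+ p} {A ℤ.+ B} p∣A+B) (ℤDiv.∣ᵤ⇒∣ {+ p} {B} p∣B)))

  p∤-abs-* : ∀ (A B : ℤ) → ¬ p ∣ ℤ.∣ A ∣ → ¬ p ∣ ℤ.∣ B ∣ → ¬ p ∣ ℤ.∣ A ℤ.* B ∣
  p∤-abs-* A B p∤A p∤B = subst (λ t → ¬ p ∣ t) (sym (ℤP.abs-* A B)) (p∤-* p∤A p∤B)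

  integral-+ : ∀ x y → Integral x → Integral y → Integral (x ℚ.+ y)
  integral-+ x@(mkℚ _ _ _) y@(mkℚ _ _ _) (integral p∤d) (integral p∤d') =
    integral-via (ℚP.toℚᵘ-homo-+ x y) (p∤-* p∤d p∤d')

  integral-* : ∀ x y → Integral x → Integral y → Integral (x ℚ.* y)
  integral-* x@(mkℚ _ _ _) y@(mkℚ _ _ _) (integral p∤d) (integral p∤d') =
    integral-via (ℚP.toℚᵘ-homo-* x y) (p∤-* p∤d p∤d')

  integral-neg : ∀ x → Integral x → Integral (ℚ.- x)
  integral-neg x@(mkℚ _ _ _) (integral p∤d) = integral-via (ℚP.toℚᵘ-homo‿- x) p∤d

  unit-* : ∀ x y → Unit x → Unit y → Unit (x ℚ.* y)
  unit-* x@(mkℚ n _ _) y@(mkℚ m _ _) (unit p∤n p∤d) (unit p∤m p∤d') =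
    unit-via (ℚP.toℚᵘ-homo-* x y) (p∤-abs-* n m p∤n p∤m) (p∤-* p∤d p∤d')

  unit-1/ : ∀ y .{{_ : ℚ.NonZero y}} → Unit y → Unit (ℚ.1/ y)
  unit-1/ (mkℚ +[1+ _ ] _ _) (unit p∤n p∤d) = unit p∤d p∤n
  unit-1/ (mkℚ -[1+ _ ] _ _) (unit p∤n p∤d) = unit p∤d p∤n

  simpleZero-1/ : ∀ y .{{_ : ℚ.NonZero y}} → SimpleZero y → SimplePole (ℚ.1/ y)
  simpleZero-1/ (mkℚ +[1+ _ ] _ _) (simpleZero e n≡pe p∤e p∤d) = simplePole e n≡pe p∤e p∤d
  simpleZero-1/ (mkℚ -[1+ _ ] _ _) (simpleZero e n≡pe p∤e p∤d) = simplePole e n≡pe p∤e p∤d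

  simplePole-+ : ∀ x y → SimplePole x → Integral y → SimplePole (x ℚ.+ y)
  simplePole-+ x@(mkℚ n d _) y@(mkℚ m d' _) (simplePole e D≡pe p∤e p∤n) (integral p∤d') =
    simplePole-via (ℚP.toℚᵘ-homo-+ x y) (e ℕ.* suc d')
      (trans (cong (_* suc d') D≡pe) (ℕP.*-assoc p e (suc d')))
      (p∤-* p∤e p∤d')
      (p∤-+ (n ℤ.* + suc d') (m ℤ.* + suc d)
        (p∤-abs-* n (+ suc d') p∤n p∤d')
        (subst (p ∣_) (sym (ℤP.abs-* m (+ suc d)))
          (∣n⇒∣m*n (ℤ.∣ m ∣) (subst (p ∣_) (sym D≡pe) (m∣m*n e)))))

  simplePole-* : ∀ x y → SimplePole x → Unit y → SimplePole (x ℚ.* y)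
  simplePole-* x@(mkℚ n d _) y@(mkℚ m d' _) (simplePole e D≡pe p∤e p∤n) (unit p∤m p∤d') =
    simplePole-via (ℚP.toℚᵘ-homo-* x y) (e ℕ.* suc d')
      (trans (cong (_* suc d') D≡pe) (ℕP.*-assoc p e (suc d')))
      (p∤-* p∤e p∤d') (p∤-abs-* n m p∤n p∤m)

  simpleZero-* : ∀ x y → SimpleZero x → Unit y → SimpleZero (x ℚ.* y)
  simpleZero-* x@(mkℚ n d _) y@(mkℚ m d' _) (simpleZero e N≡pe p∤e p∤d) (unit p∤m p∤d') =
    simpleZero-via (ℚP.toℚᵘ-homo-* x y) (e ℕ.* ℤ.∣ m ∣)
      (trans (ℤP.abs-* n m) (trans (cong (_* ℤ.∣ m ∣) N≡pe) (ℕP.*-assoc p e (ℤ.∣ m ∣))))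
      (p∤-* p∤e p∤m) (p∤-* p∤d p∤d')

  integral-ℤ : ∀ z → Integral (ℤ→ℚ z)
  integral-ℤ z = integral-via {ℤ→ℚ z} {U.mkℚᵘ z 0} (ℚP.toℚᵘ-fromℚᵘ (U.mkℚᵘ z 0)) p∤1

  integral-ℕ : ∀ n → Integral (ℕ→ℚ n)
  integral-ℕ n = integral-ℤ (+ n)

  integral-0 : Integral 0ℚ
  integral-0 = integral p∤1

  unit-1 : Unit 1ℚ
  unit-1 = unit p∤1 p∤1

  unit-fraction : ∀ z d → ¬ p ∣ ℤ.∣ z ∣ → ¬ p ∣ suc d → Unit (z ℚ./ suc d)
  unit-fraction z d p∤z p∤d =
    unit-via {z ℚ./ suc d} {U.mkℚᵘ z d} (ℚP.toℚᵘ-fromℚᵘ (U.mkℚᵘ z d)) p∤z p∤d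

  unit≢0 : ∀ {r} → Unit r → r ≢ 0ℚ
  unit≢0 (unit p∤n _) refl = p∤n (_ ∣0)

  simpleZero≢0 : ∀ {r} → SimpleZero r → r ≢ 0ℚ
  simpleZero≢0 (simpleZero e 0≡pe p∤e _) refl with ℕP.m*n≡0⇒m≡0∨n≡0 p {e} (sym 0≡pe)
  ... | inj₁ p≡0 = ℕP.<-irrefl (sym p≡0) (ℕP.<-trans (s≤s z≤n) 1<p)
  ... | inj₂ refl = p∤e (_ ∣0)

  simplePole≢0 : ∀ {r} → SimplePole r → r ≢ 0ℚ
  simplePole≢0 (simplePole e 1≡pe _ _) refl = p∤1 (subst (p ∣_) (sym 1≡pe) (m∣m*n e))

  divℚ-≢0 : ∀ x y (y≢0 : y ≢ 0ℚ) → divℚ x y ≡ x ℚ.* ℚ.1/_ y {{ℚ.≢-nonZero y≢0}}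
  divℚ-≢0 x y y≢0 with y ℚP.≟ 0ℚ
  ... | yes y≡0 = ⊥-elim (y≢0 y≡0)
  ... | no _ = refl

  unit-÷ : ∀ x y → Unit x → Unit y → Unit (divℚ x y)
  unit-÷ x y ux uy = subst Unit (sym (divℚ-≢0 x y y≢0))
    (unit-* x _ ux (unit-1/ y {{ℚ.≢-nonZero y≢0}} uy))
    where y≢0 = unit≢0 uy

  unit-÷-simpleZero : ∀ x y → Unit x → SimpleZero y → SimplePole (divℚ x y)
  unit-÷-simpleZero x y ux zy = subst SimplePole (trans (ℚP.*-comm _ x) (sym (divℚ-≢0 x y y≢0)))
    (simplePole-* _ x (simpleZero-1/ y {{ℚ.≢-nonZero y≢0}} zy) ux)
    where y≢0 = simpleZero≢0 zy

  -- the scaled valuation of a simple pole is -1 (the constant 1728^α is a p-unit)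
  vpScaled-simplePole : ∀ α r → ¬ p ∣ 1728 → SimplePole r → vpScaled p α r ≡ ℚ.- 1ℚ
  vpScaled-simplePole α r p∤1728 (simplePole e D≡pe p∤e p∤n)
    rewrite vpℕ-coprime p 1728 1<p p∤1728 | vpℕ-coprime p (num r) 1<p p∤n
          | vpℕ-simple p (↧ₙ r) e 1<p D≡pe p∤e
    = cong (ℚ._+ ℤ→ℚ (-[1+ 0 ])) (ℚP.*-zeroʳ α)

module SeriesFacts where
  open import Data.Nat using (_∸_; _≤_; _<_)

  sumTo-zero : ∀ n h → (∀ i → i ≤ n → h i ≡ 0ℚ) → sumTo n h ≡ 0ℚ
  sumTo-zero zero h h≡0 = h≡0 0 z≤n
  sumTo-zero (suc n) h h≡0 =
    cong₂ ℚ._+_ (sumTo-zero n h (λ i i≤n → h≡0 i (ℕP.m≤n⇒m≤1+n i≤n))) (h≡0 (suc n) ℕP.≤-refl)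

  sumTo-single : ∀ n h j → j ≤ n → (∀ i → i ≤ n → i ≢ j → h i ≡ 0ℚ) → sumTo n h ≡ h j
  sumTo-single zero h zero _ _ = refl
  sumTo-single (suc n) h j j≤1+n others with j ℕ.≟ suc n
  ... | yes refl = begin
    sumTo n h ℚ.+ h (suc n) ≡⟨ cong (ℚ._+ h (suc n)) (sumTo-zero n h below) ⟩
    0ℚ ℚ.+ h (suc n)        ≡⟨ ℚP.+-identityˡ (h (suc n)) ⟩
    h (suc n)               ∎
    where
    open ≡-Reasoning
    below : ∀ i → i ≤ n → h i ≡ 0ℚ
    below i i≤n = others i (ℕP.m≤n⇒m≤1+n i≤n) (λ i≡1+n → ℕP.<-irrefl i≡1+n (s≤s i≤n))
  ... | no j≢1+n = begin
    sumTo n h ℚ.+ h (suc n) ≡⟨ cong₂ ℚ._+_ (sumTo-single n h j j≤n (λ i i≤n → others i (ℕP.m≤n⇒m≤1+n i≤n)))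
                                            (others (suc n) ℕP.≤-refl (λ 1+n≡j → j≢1+n (sym 1+n≡j))) ⟩
    h j ℚ.+ 0ℚ              ≡⟨ ℚP.+-identityʳ (h j) ⟩
    h j                     ∎
    where
    open ≡-Reasoning
    j≤n = ℕP.≤-pred (ℕP.≤∧≢⇒< j≤1+n j≢1+n)

  ∸-suc-< : ∀ m i k → suc i ≤ m → m ≤ k → m ∸ suc i < k
  ∸-suc-< (suc m) i k _ m≤k = ℕP.≤-trans (s≤s (ℕP.m∸n≤m m i)) m≤k

  npowS-below : ∀ Z → Z 0 ≡ 0ℚ → ∀ k m → m < k → npowS Z k m ≡ 0ℚ
  npowS-below Z Z₀≡0 (suc k) m m<1+k = sumTo-zero m _ term≡0
    where
    term≡0 : ∀ i → i ≤ m → Z i ℚ.* npowS Z k (m ∸ i) ≡ 0ℚ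
    term≡0 zero _ = trans (cong (ℚ._* npowS Z k m) Z₀≡0) (ℚP.*-zeroˡ (npowS Z k m))
    term≡0 (suc i) 1+i≤m =
      trans (cong (Z (suc i) ℚ.*_) (npowS-below Z Z₀≡0 k (m ∸ suc i) (∸-suc-< m i k 1+i≤m (ℕP.≤-pred m<1+k))))
            (ℚP.*-zeroʳ (Z (suc i)))

  npowS-diagonal : ∀ Z → Z 0 ≡ 0ℚ → ∀ k → npowS Z (suc k) (suc k) ≡ Z 1 ℚ.* npowS Z k k
  npowS-diagonal Z Z₀≡0 k = sumTo-single (suc k) _ 1 (s≤s z≤n) term≡0
    where
    term≡0 : ∀ i → i ≤ suc k → i ≢ 1 → Z i ℚ.* npowS Z k (suc k ∸ i) ≡ 0ℚ
    term≡0 zero _ _ = trans (cong (ℚ._* npowS Z k (suc k)) Z₀≡0) (ℚP.*-zeroˡ (npowS Z k (suc k)))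
    term≡0 (suc zero) _ i≢1 = ⊥-elim (i≢1 refl)
    term≡0 (suc (suc i)) (s≤s 2+i≤1+k) _ =
      trans (cong (Z (suc (suc i)) ℚ.*_) (npowS-below Z Z₀≡0 k (k ∸ suc i) (∸-suc-< k i k 2+i≤1+k ℕP.≤-refl)))
            (ℚP.*-zeroʳ (Z (suc (suc i))))

module LocalSeries (p : ℕ) (p-prime : Prime p) where
  open import Data.Nat using (_*_; _∸_; _≤_; _<_)
  open LocalRationals p p-prime public
  open SeriesFacts

  IntegralUpTo : ℕ → Series → Set
  IntegralUpTo N s = ∀ j → j ≤ N → Integral (s j)

  sumTo-integral : ∀ n h → (∀ i → i ≤ n → Integral (h i)) → Integral (sumTo n h)
  sumTo-integral zero h int = int 0 z≤n
  sumTo-integral (suc n) h int =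
    integral-+ _ _ (sumTo-integral n h (λ i i≤n → int i (ℕP.m≤n⇒m≤1+n i≤n))) (int (suc n) ℕP.≤-refl)

  mulS-integral : ∀ N f g → IntegralUpTo N f → IntegralUpTo N g → IntegralUpTo N (mulS f g)
  mulS-integral N f g int-f int-g i i≤N = sumTo-integral i _ λ j j≤i →
    integral-* _ _ (int-f j (ℕP.≤-trans j≤i i≤N)) (int-g (i ∸ j) (ℕP.≤-trans (ℕP.m∸n≤m i j) i≤N))

  oneS-integral : ∀ N → IntegralUpTo N oneS
  oneS-integral N zero _ = unit⇒integral unit-1
  oneS-integral N (suc j) _ = integral-0

  npowS-integral : ∀ N f → IntegralUpTo N f → ∀ k → IntegralUpTo N (npowS f k)
  npowS-integral N f int-f zero = oneS-integral N
  npowS-integral N f int-f (suc k) = mulS-integral N f _ int-f (npowS-integral N f int-f k)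

  gbinom-integral : ∀ r k → Integral r → k < p → Integral (gbinom r k)
  gbinom-integral r zero _ _ = unit⇒integral unit-1
  gbinom-integral r (suc k) int-r 1+k<p =
    integral-* _ _
      (integral-* _ _ (gbinom-integral r k int-r (ℕP.<-trans (ℕP.n<1+n k) 1+k<p))
                      (integral-+ _ _ int-r (integral-neg _ (integral-ℕ k))))
      (unit⇒integral (unit-fraction (+ 1) k p∤1 (p∤-small (s≤s z≤n) 1+k<p)))

  powS-integral : ∀ N r s → Integral r → N < p → IntegralUpTo N s → IntegralUpTo N (powS r s)
  powS-integral N r s int-r N<p int-s i i≤N = sumTo-integral i _ λ k k≤i →
    integral-* _ _ (gbinom-integral r k int-r (ℕP.≤-<-trans (ℕP.≤-trans k≤i i≤N) N<p))
      (npowS-integral N _ (λ j j≤N → integral-+ _ _ (int-s j j≤N) (integral-neg _ (oneS-integral N j j≤N)))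
                      k i i≤N)

  oneMinusQ-integral : ∀ m i → Integral (oneMinusQ m i)
  oneMinusQ-integral m i with i ℕ.≟ 0 | i ℕ.≟ m
  ... | yes _ | _ = unit⇒integral unit-1
  ... | no _ | yes _ = integral-neg _ (unit⇒integral unit-1)
  ... | no _ | no _ = integral-0

  finEuler-integral : ∀ N M → IntegralUpTo N (finEuler M)
  finEuler-integral N zero = oneS-integral N
  finEuler-integral N (suc M) =
    mulS-integral N _ _ (finEuler-integral N M) (λ j _ → oneMinusQ-integral (suc M) j)

  eulerS-integral : ∀ N → IntegralUpTo N eulerS
  eulerS-integral N j _ = finEuler-integral j j j ℕP.≤-refl

  E4S-integral : ∀ N → IntegralUpTo N E4S
  E4S-integral N zero _ = unit⇒integral unit-1
  E4S-integral N (suc j) _ = integral-ℕ (240 * sigma3 (suc j))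

  jInvTilde-integral : ∀ N → N < p → IntegralUpTo N jInvTilde
  jInvTilde-integral N N<p =
    mulS-integral N _ _ (powS-integral N _ _ (integral-ℕ 24) N<p (eulerS-integral N))
                        (powS-integral N _ _ (integral-neg _ (integral-ℕ 3)) N<p (E4S-integral N))

  JinvS-integral : ∀ N → N < p → IntegralUpTo N JinvS
  JinvS-integral N N<p zero _ = integral-0
  JinvS-integral N N<p (suc j) 1+j≤N =
    integral-* _ _ (integral-ℕ 1728) (jInvTilde-integral N N<p j (ℕP.≤-trans (ℕP.n≤1+n j) 1+j≤N))

  -- the diagonal coefficient (J⁻¹)^k_k = 1728^k is a unit
  JinvS-diagonal-unit : ¬ p ∣ 1728 → ∀ k → Unit (npowS JinvS k k)
  JinvS-diagonal-unit p∤1728 zero = unit-1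
  JinvS-diagonal-unit p∤1728 (suc k) =
    subst Unit (sym (npowS-diagonal JinvS refl k))
      (unit-* _ _ (unit-* _ _ (unit-fraction (+ 1728) 0 p∤1728 p∤1) unit-1) (JinvS-diagonal-unit p∤1728 k))

  sumTo-simplePole : ∀ n h j → j ≤ n → SimplePole (h j) → (∀ i → i ≤ n → i ≢ j → Integral (h i)) →
                     SimplePole (sumTo n h)
  sumTo-simplePole zero h zero _ pole _ = pole
  sumTo-simplePole (suc n) h j j≤1+n pole others with j ℕ.≟ suc n
  ... | yes refl = subst SimplePole (ℚP.+-comm (h (suc n)) (sumTo n h))
    (simplePole-+ _ _ pole (sumTo-integral n h λ i i≤n →
      others i (ℕP.m≤n⇒m≤1+n i≤n) (λ i≡1+n → ℕP.<-irrefl i≡1+n (s≤s i≤n))))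
  ... | no j≢1+n = simplePole-+ _ _
    (sumTo-simplePole n h j (ℕP.≤-pred (ℕP.≤∧≢⇒< j≤1+n j≢1+n)) pole
      (λ i i≤n → others i (ℕP.m≤n⇒m≤1+n i≤n)))
    (others (suc n) ℕP.≤-refl (λ 1+n≡j → j≢1+n (sym 1+n≡j)))

  mulS-simplePole : ∀ n f g → Unit (f 0) → SimplePole (g n) → (∀ i → i < n → Integral (g i)) →
                    (∀ i → i ≤ n → Integral (f i)) → SimplePole (mulS f g n)
  mulS-simplePole n f g unit-f₀ pole-gₙ int-g int-f =
    sumTo-simplePole n _ 0 z≤n (subst SimplePole (ℚP.*-comm (g n) (f 0)) (simplePole-* _ _ pole-gₙ unit-f₀))
      λ { zero _ 0≢0 → ⊥-elim (0≢0 refl)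
        ; (suc i) 1+i≤n _ → integral-* _ _ (int-f (suc i) 1+i≤n) (int-g (n ∸ suc i) (∸-suc-< n i n 1+i≤n ℕP.≤-refl)) }

  record UnitStep (A B C : ℚ) (j : ℕ) : Set where
    constructor unitStep
    field A+j : Unit (A ℚ.+ ℕ→ℚ j)
          B+j : Unit (B ℚ.+ ℕ→ℚ j)
          C+j : Unit (C ℚ.+ ℕ→ℚ j)
          1+j : Unit (ℕ→ℚ (suc j))

  record PoleStep (A B C : ℚ) (j : ℕ) : Set where
    constructor poleStep
    field A+j : Unit (A ℚ.+ ℕ→ℚ j)
          B+j : Unit (B ℚ.+ ℕ→ℚ j)
          C+j : SimpleZero (C ℚ.+ ℕ→ℚ j)
          1+j : Unit (ℕ→ℚ (suc j))

  hypCoeff-unit : ∀ A B C k → (∀ j → j < k → UnitStep A B C j) → Unit (hypCoeff A B C k)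
  hypCoeff-unit A B C zero _ = unit-1
  hypCoeff-unit A B C (suc k) steps with steps k ℕP.≤-refl
  ... | unitStep uA uB uC uN =
    unit-÷ _ _ (unit-* _ _ (unit-* _ _ (hypCoeff-unit A B C k (λ j j<k → steps j (ℕP.m≤n⇒m≤1+n j<k))) uA) uB)
               (unit-* _ _ uC uN)

  hypCoeff-simplePole : ∀ A B C m → Unit (hypCoeff A B C m) → PoleStep A B C m →
                        SimplePole (hypCoeff A B C (suc m))
  hypCoeff-simplePole A B C m unit-m (poleStep uA uB zC uN) =
    unit-÷-simpleZero _ _ (unit-* _ _ (unit-* _ _ unit-m uA) uB) (simpleZero-* _ _ zC uN)

  modFormSeries-simplePole : ∀ m (k₀ : ℤ) (A B C : ℚ) → suc m < p → ¬ p ∣ 1728 → Integral A →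
    (∀ j → j < m → UnitStep A B C j) → PoleStep A B C m →
    SimplePole (modFormSeries k₀ A B C (suc m))
  modFormSeries-simplePole m k₀ A B C n<p p∤1728 int-A steps last =
    mulS-simplePole n E (mulS Jpow H) unit-1 pole-JH int-JH
      (powS-integral n _ _ (integral-ℤ (+ 2 ℤ.* k₀)) n<p (eulerS-integral n))
    where
    n = suc m
    E = powS (ℤ→ℚ (+ 2 ℤ.* k₀)) eulerS
    Jpow = powS A jInvTilde
    H = hypComp A B C JinvS
    HC-unit : ∀ k → k ≤ m → Unit (hypCoeff A B C k)
    HC-unit k k≤m = hypCoeff-unit A B C k (λ j j<k → steps j (ℕP.<-≤-trans j<k k≤m))
    -- F(A,B;C;J⁻¹)_n: only the k = n term has a pole, since (J⁻¹)^k starts in degree k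
    pole-H : SimplePole (H n)
    pole-H = sumTo-simplePole n _ n ℕP.≤-refl
      (simplePole-* _ _ (hypCoeff-simplePole A B C m (HC-unit m ℕP.≤-refl) last)
                        (JinvS-diagonal-unit p∤1728 n))
      λ i i≤n i≢n → integral-* _ _ (unit⇒integral (HC-unit i (ℕP.≤-pred (ℕP.≤∧≢⇒< i≤n i≢n))))
                                   (npowS-integral n JinvS (JinvS-integral n n<p) i n ℕP.≤-refl)
    int-H : ∀ i → i < n → IntegralUpTo i H
    int-H i i<n j j≤i = sumTo-integral j _ λ k k≤j →
      integral-* _ _ (unit⇒integral (HC-unit k (ℕP.≤-pred (ℕP.≤-<-trans (ℕP.≤-trans k≤j j≤i) i<n))))
                     (npowS-integral j JinvS (JinvS-integral j (ℕP.≤-<-trans (ℕP.≤-trans j≤i (ℕP.<⇒≤ i<n)) n<p)) k j ℕP.≤-refl)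
    int-J : ∀ i → i ≤ n → IntegralUpTo i Jpow
    int-J i i≤n = powS-integral i A jInvTilde int-A (ℕP.≤-<-trans i≤n n<p)
                                (jInvTilde-integral i (ℕP.≤-<-trans i≤n n<p))
    pole-JH : SimplePole (mulS Jpow H n)
    pole-JH = mulS-simplePole n Jpow H unit-1 pole-H (λ i i<n → int-H i i<n i ℕP.≤-refl)
                              (λ i i≤n → int-J n ℕP.≤-refl i i≤n)
    int-JH : ∀ i → i < n → Integral (mulS Jpow H i)
    int-JH i i<n = mulS-integral i Jpow H (int-J i (ℕP.<⇒≤ i<n)) (int-H i i<n) i ℕP.≤-refl

module PrimeInProgression (p Q R m : ℕ) (p-prime : Prime p) (p≡Qn+R : p ≡ Q ℕ.* suc m ℕ.+ R)
                          (6≤Q : 6 ℕ.≤ Q) (1≤R : 1 ℕ.≤ R) where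
  open import Data.Nat using (_+_; _*_; _∸_; _≤_; _<_)
  open import Relation.Binary.Definitions using (tri<; tri≈; tri>)
  open PrimeDivisibility p p-prime

  n : ℕ
  n = suc m

  Qn<p : Q * n < p
  Qn<p = subst (Q * n <_) (sym p≡Qn+R)
           (subst (_< Q * n + R) (ℕP.+-identityʳ (Q * n)) (ℕP.+-monoʳ-< (Q * n) 1≤R))

  6n<p : 6 * n < p
  6n<p = ℕP.≤-<-trans (ℕP.*-monoˡ-≤ n 6≤Q) Qn<p

  n<p : n < p
  n<p = ℕP.≤-<-trans (ℕP.m≤n*m n 6) 6n<p

  7≤p : 7 ≤ p
  7≤p = ℕP.≤-trans (s≤s (ℕP.≤-trans 6≤Q (ℕP.m≤m*n Q n))) Qn<p

  p∤Q : ¬ p ∣ Q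
  p∤Q = p∤-small (ℕP.<-≤-trans (s≤s z≤n) 6≤Q) (ℕP.≤-<-trans (ℕP.m≤m*n Q n) Qn<p)

  p∤12 : ¬ p ∣ 12
  p∤12 = p∤-* {2} {6} (p∤-small (s≤s z≤n) (ℕP.≤-trans (s≤s (s≤s (s≤s z≤n))) 7≤p))
                      (p∤-small (s≤s z≤n) 7≤p)

  p∤1728 : ¬ p ∣ 1728
  p∤1728 = p∤-* {12} {144} p∤12 (p∤-* {12} {12} p∤12 p∤12)

  p∤12Q : ¬ p ∣ 12 * Q
  p∤12Q = p∤-* p∤12 p∤Q

  p∤1+j : ∀ j → j ≤ m → ¬ p ∣ suc j
  p∤1+j j j≤m = p∤-small (s≤s z≤n) (ℕP.≤-<-trans (s≤s j≤m) n<p)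

  p∤Q*small : ∀ {s} → 0 < s → s < p → ¬ p ∣ Q * s
  p∤Q*small 0<s s<p = p∤-* p∤Q (p∤-small 0<s s<p)

  6p≡ : 6 * p ≡ Q * (6 * n) + 6 * R
  6p≡ = trans (cong (6 *_) p≡Qn+R) (rearrange Q n R)
    where
    rearrange : ∀ Q n R → 6 * (Q * n + R) ≡ Q * (6 * n) + 6 * R
    rearrange = solve-∀

  spread : ∀ Q x s R → Q * (x + s) + 6 * R ≡ (Q * x + 6 * R) + Q * s
  spread = solve-∀

  -- Since 6p = Q·6n + 6R, the number Q·t + 6R differs from a multiple of p by
  -- ±Q·(t - 6n), which p does not divide when 0 < |t - 6n| ≤ 6n.
  p∤-off-centre : ∀ t → t ≢ 6 * n → t ≤ 12 * n → ¬ p ∣ Q * t + 6 * R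
  p∤-off-centre t t≢6n t≤12n p∣ with ℕP.<-cmp t (6 * n)
  ... | tri≈ _ t≡6n _ = t≢6n t≡6n
  ... | tri< t<6n _ _ =
    p∤Q*small (ℕP.m<n⇒0<n∸m t<6n) (ℕP.≤-<-trans (ℕP.m∸n≤m (6 * n) t) 6n<p)
      (∣m+n∣m⇒∣n (subst (p ∣_) 6p≡sum (∣n⇒∣m*n 6 ∣-refl)) p∣)
    where
    6p≡sum : 6 * p ≡ (Q * t + 6 * R) + Q * (6 * n ∸ t)
    6p≡sum = trans 6p≡ (trans (cong (λ x → Q * x + 6 * R) (sym (ℕP.m+[n∸m]≡n (ℕP.<⇒≤ t<6n))))
                               (spread Q t (6 * n ∸ t) R))
  ... | tri> _ _ 6n<t =
    p∤Q*small (ℕP.m<n⇒0<n∸m 6n<t) (ℕP.≤-<-trans excess≤6n 6n<p)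
      (∣m+n∣m⇒∣n (subst (p ∣_) sum≡6p+ p∣) (∣n⇒∣m*n 6 ∣-refl))
    where
    sum≡6p+ : Q * t + 6 * R ≡ 6 * p + Q * (t ∸ 6 * n)
    sum≡6p+ = begin
      Q * t + 6 * R                        ≡⟨ cong (λ x → Q * x + 6 * R) (sym (ℕP.m+[n∸m]≡n (ℕP.<⇒≤ 6n<t))) ⟩
      Q * (6 * n + (t ∸ 6 * n)) + 6 * R    ≡⟨ spread Q (6 * n) (t ∸ 6 * n) R ⟩
      Q * (6 * n) + 6 * R + Q * (t ∸ 6 * n) ≡⟨ cong (_+ Q * (t ∸ 6 * n)) (sym 6p≡) ⟩
      6 * p + Q * (t ∸ 6 * n)              ∎
      where open ≡-Reasoning
    12n≡6n+6n : ∀ n → 12 * n ≡ 6 * n + 6 * n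
    12n≡6n+6n = solve-∀
    excess≤6n : t ∸ 6 * n ≤ 6 * n
    excess≤6n = subst (t ∸ 6 * n ≤_) (trans (cong (_∸ 6 * n) (12n≡6n+6n n)) (ℕP.m+n∸n≡m (6 * n) (6 * n)))
                      (ℕP.∸-monoˡ-≤ (6 * n) t≤12n)

  within : ∀ j k → j ≤ m → k ≤ 12 → 12 * j + k ≤ 12 * n
  within j k j≤m k≤12 = subst (12 * j + k ≤_) (12m+12 m) (ℕP.+-mono-≤ (ℕP.*-monoʳ-≤ 12 j≤m) k≤12)
    where
    12m+12 : ∀ m → 12 * m + 12 ≡ 12 * suc m
    12m+12 = solve-∀

  6n≡2*3n : ∀ n → 6 * n ≡ 2 * (3 * n)
  6n≡2*3n = solve-∀

  -- the numerators of A + j and B + j: 12j+1 and 12j+5 are odd, hence off the centre 6n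
  p∤-numeratorA : ∀ j → j ≤ m → ¬ p ∣ Q * (12 * j + 1) + 6 * R
  p∤-numeratorA j j≤m = p∤-off-centre (12 * j + 1) odd (within j 1 j≤m (s≤s z≤n))
    where
    12j+1≡ : ∀ j → 12 * j + 1 ≡ suc (2 * (6 * j))
    12j+1≡ = solve-∀
    odd : 12 * j + 1 ≢ 6 * n
    odd eq = ℕP.even≢odd (3 * n) (6 * j) (trans (sym (6n≡2*3n n)) (trans (sym eq) (12j+1≡ j)))

  p∤-numeratorB : ∀ j → j ≤ m → ¬ p ∣ Q * (12 * j + 5) + 6 * R
  p∤-numeratorB j j≤m = p∤-off-centre (12 * j + 5) odd (within j 5 j≤m (s≤s (s≤s (s≤s (s≤s (s≤s z≤n))))))
    where
    12j+5≡ : ∀ j → 12 * j + 5 ≡ suc (2 * (6 * j + 2))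
    12j+5≡ = solve-∀
    odd : 12 * j + 5 ≢ 6 * n
    odd eq = ℕP.even≢odd (3 * n) (6 * j + 2) (trans (sym (6n≡2*3n n)) (trans (sym eq) (12j+5≡ j)))

  p∤-numeratorC : ∀ j → j < m → ¬ p ∣ Q * (j + 1) + R
  p∤-numeratorC j j<m = p∤-small (ℕP.≤-trans 1≤R (ℕP.m≤n+m R (Q * (j + 1))))
    (subst (Q * (j + 1) + R <_) (sym p≡Qn+R)
      (ℕP.+-monoˡ-< R (ℕP.*-monoʳ-< Q {{Q≢0}} (subst (_< n) (ℕP.+-comm 1 j) (s≤s j<m)))))
    where
    Q≢0 : NonZero Q
    Q≢0 = ℕ.>-nonZero (ℕP.<-≤-trans (s≤s z≤n) 6≤Q)

  numeratorC-last : Q * (m + 1) + R ≡ p * 1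
  numeratorC-last = trans (cong (λ x → Q * x + R) (ℕP.+-comm m 1))
                          (trans (sym p≡Qn+R) (sym (ℕP.*-identityʳ p)))

module ParameterFractions where
  open import Data.Rational using (_+_; _*_; _-_; -_)
  open import Data.Rational.Solver using (module +-*-Solver)
  open +-*-Solver

  ℤ→ℚ-+ : ∀ a b → ℤ→ℚ (a ℤ.+ b) ≡ ℤ→ℚ a + ℤ→ℚ b
  ℤ→ℚ-+ a b = ℚP.toℚᵘ-injective (UP.≃-trans (ℚP.toℚᵘ-fromℚᵘ (U.mkℚᵘ (a ℤ.+ b) 0))
    (UP.≃-trans sum≃ (UP.≃-sym (UP.≃-trans (ℚP.toℚᵘ-homo-+ (ℤ→ℚ a) (ℤ→ℚ b))
      (UP.+-cong (ℚP.toℚᵘ-fromℚᵘ (U.mkℚᵘ a 0)) (ℚP.toℚᵘ-fromℚᵘ (U.mkℚᵘ b 0)))))))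
    where
    sum≃ : U.mkℚᵘ (a ℤ.+ b) 0 U.≃ (U.mkℚᵘ a 0 U.+ U.mkℚᵘ b 0)
    sum≃ = U.*≡* (cong (ℤ._* + 1) (cong₂ ℤ._+_ (sym (ℤP.*-identityʳ a)) (sym (ℤP.*-identityʳ b))))

  ℤ→ℚ-* : ∀ a b → ℤ→ℚ (a ℤ.* b) ≡ ℤ→ℚ a * ℤ→ℚ b
  ℤ→ℚ-* a b = ℚP.toℚᵘ-injective (UP.≃-trans (ℚP.toℚᵘ-fromℚᵘ (U.mkℚᵘ (a ℤ.* b) 0))
    (UP.≃-sym (UP.≃-trans (ℚP.toℚᵘ-homo-* (ℤ→ℚ a) (ℤ→ℚ b))
      (UP.*-cong (ℚP.toℚᵘ-fromℚᵘ (U.mkℚᵘ a 0)) (ℚP.toℚᵘ-fromℚᵘ (U.mkℚᵘ b 0))))))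

  ℕ→ℚ-+ : ∀ a b → ℕ→ℚ (a ℕ.+ b) ≡ ℕ→ℚ a + ℕ→ℚ b
  ℕ→ℚ-+ a b = ℤ→ℚ-+ (+ a) (+ b)

  ℕ→ℚ-* : ∀ a b → ℕ→ℚ (a ℕ.* b) ≡ ℕ→ℚ a * ℕ→ℚ b
  ℕ→ℚ-* a b = trans (cong ℤ→ℚ (ℤP.pos-* a b)) (ℤ→ℚ-* (+ a) (+ b))

  fraction-rep : ∀ x N D → x * ℕ→ℚ (suc D) ≡ ℤ→ℚ N → toℚᵘ x U.≃ U.mkℚᵘ N D
  fraction-rep x@(mkℚ a e _) N D eq
    with UP.≃-trans (UP.≃-sym (UP.≃-trans (ℚP.toℚᵘ-homo-* x (ℕ→ℚ (suc D)))
                                           (UP.*-congˡ {toℚᵘ x} (ℚP.toℚᵘ-fromℚᵘ (U.mkℚᵘ (+ suc D) 0)))))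
                    (UP.≃-trans (ℚP.toℚᵘ-cong eq) (ℚP.toℚᵘ-fromℚᵘ (U.mkℚᵘ N 0)))
  ... | U.*≡* cross = U.*≡* (trans (sym (ℤP.*-identityʳ _))
                                   (trans cross (cong (λ t → N ℤ.* + t) (ℕP.*-identityʳ (suc e)))))

  cast-12 : ∀ Q j k R → ℕ→ℚ (Q ℕ.* (12 ℕ.* j ℕ.+ k) ℕ.+ 6 ℕ.* R)
                      ≡ ℕ→ℚ Q * (ℕ→ℚ 12 * ℕ→ℚ j + ℕ→ℚ k) + ℕ→ℚ 6 * ℕ→ℚ R
  cast-12 Q j k R = trans (ℕ→ℚ-+ (Q ℕ.* (12 ℕ.* j ℕ.+ k)) (6 ℕ.* R))
    (cong₂ _+_ (trans (ℕ→ℚ-* Q (12 ℕ.* j ℕ.+ k))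
                      (cong (ℕ→ℚ Q *_) (trans (ℕ→ℚ-+ (12 ℕ.* j) k) (cong (_+ ℕ→ℚ k) (ℕ→ℚ-* 12 j)))))
               (ℕ→ℚ-* 6 R))

  cast-1 : ∀ Q j R → ℕ→ℚ (Q ℕ.* (j ℕ.+ 1) ℕ.+ R) ≡ ℕ→ℚ Q * (ℕ→ℚ j + ℕ→ℚ 1) + ℕ→ℚ R
  cast-1 Q j R = trans (ℕ→ℚ-+ (Q ℕ.* (j ℕ.+ 1)) R)
    (cong (_+ ℕ→ℚ R) (trans (ℕ→ℚ-* Q (j ℕ.+ 1)) (cong (ℕ→ℚ Q *_) (ℕ→ℚ-+ j 1))))

  α : ℚ → ℚ
  α δ = (+ 1 ℚ./ 12) + δ * (+ 1 ℚ./ 2)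

  α' : ℚ → ℚ
  α' δ = (+ 1 ℚ./ 12) - δ * (+ 1 ℚ./ 2)

  c : ℚ
  c = + 2 ℚ./ 3

  module _ (δ : ℚ) (Q R : ℕ) (δQ≡R : δ * ℕ→ℚ Q ≡ ℕ→ℚ R) where
    private
      q = ℕ→ℚ Q
      r = ℕ→ℚ R

    clear-12Q : ∀ X j k → X * (ℕ→ℚ 12 * q) ≡ q * (ℕ→ℚ 12 * ℕ→ℚ j + ℕ→ℚ k) + ℕ→ℚ 6 * (δ * q) →
                X * ℕ→ℚ (12 ℕ.* Q) ≡ ℕ→ℚ (Q ℕ.* (12 ℕ.* j ℕ.+ k) ℕ.+ 6 ℕ.* R)
    clear-12Q X j k identity = begin
      X * ℕ→ℚ (12 ℕ.* Q)                                   ≡⟨ cong (X *_) (ℕ→ℚ-* 12 Q) ⟩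
      X * (ℕ→ℚ 12 * q)                                      ≡⟨ identity ⟩
      q * (ℕ→ℚ 12 * ℕ→ℚ j + ℕ→ℚ k) + ℕ→ℚ 6 * (δ * q)       ≡⟨ cong (λ t → q * (ℕ→ℚ 12 * ℕ→ℚ j + ℕ→ℚ k) + ℕ→ℚ 6 * t) δQ≡R ⟩
      q * (ℕ→ℚ 12 * ℕ→ℚ j + ℕ→ℚ k) + ℕ→ℚ 6 * r             ≡⟨ sym (cast-12 Q j k R) ⟩
      ℕ→ℚ (Q ℕ.* (12 ℕ.* j ℕ.+ k) ℕ.+ 6 ℕ.* R)             ∎
      where open ≡-Reasoning

    α-fraction : ∀ j → (α δ + ℕ→ℚ j) * ℕ→ℚ (12 ℕ.* Q) ≡ ℕ→ℚ (Q ℕ.* (12 ℕ.* j ℕ.+ 1) ℕ.+ 6 ℕ.* R)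
    α-fraction j = clear-12Q (α δ + ℕ→ℚ j) j 1 (identity δ q (ℕ→ℚ j))
      where
      identity : ∀ δ q J → (α δ + J) * (ℕ→ℚ 12 * q) ≡ q * (ℕ→ℚ 12 * J + ℕ→ℚ 1) + ℕ→ℚ 6 * (δ * q)
      identity = solve 3 (λ δ q J →
        (con (+ 1 ℚ./ 12) :+ δ :* con (+ 1 ℚ./ 2) :+ J) :* (con (ℕ→ℚ 12) :* q)
          := q :* (con (ℕ→ℚ 12) :* J :+ con (ℕ→ℚ 1)) :+ con (ℕ→ℚ 6) :* (δ :* q)) refl

    β-fraction : ∀ j → (1ℚ + α δ - c + ℕ→ℚ j) * ℕ→ℚ (12 ℕ.* Q) ≡ ℕ→ℚ (Q ℕ.* (12 ℕ.* j ℕ.+ 5) ℕ.+ 6 ℕ.* R)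
    β-fraction j = clear-12Q (1ℚ + α δ - c + ℕ→ℚ j) j 5 (identity δ q (ℕ→ℚ j))
      where
      identity : ∀ δ q J → (1ℚ + α δ - c + J) * (ℕ→ℚ 12 * q) ≡ q * (ℕ→ℚ 12 * J + ℕ→ℚ 5) + ℕ→ℚ 6 * (δ * q)
      identity = solve 3 (λ δ q J →
        (con 1ℚ :+ (con (+ 1 ℚ./ 12) :+ δ :* con (+ 1 ℚ./ 2)) :- con c :+ J) :* (con (ℕ→ℚ 12) :* q)
          := q :* (con (ℕ→ℚ 12) :* J :+ con (ℕ→ℚ 5)) :+ con (ℕ→ℚ 6) :* (δ :* q)) refl

    γ-fraction : ∀ j → (1ℚ + α δ - α' δ + ℕ→ℚ j) * q ≡ ℕ→ℚ (Q ℕ.* (j ℕ.+ 1) ℕ.+ R)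
    γ-fraction j = begin
      (1ℚ + α δ - α' δ + ℕ→ℚ j) * q  ≡⟨ identity δ q (ℕ→ℚ j) ⟩
      q * (ℕ→ℚ j + ℕ→ℚ 1) + δ * q   ≡⟨ cong (λ t → q * (ℕ→ℚ j + ℕ→ℚ 1) + t) δQ≡R ⟩
      q * (ℕ→ℚ j + ℕ→ℚ 1) + r       ≡⟨ sym (cast-1 Q j R) ⟩
      ℕ→ℚ (Q ℕ.* (j ℕ.+ 1) ℕ.+ R)    ∎
      where
      open ≡-Reasoning
      identity : ∀ δ q J → (1ℚ + α δ - α' δ + J) * q ≡ q * (J + ℕ→ℚ 1) + δ * q
      identity = solve 3 (λ δ q J →
        (con 1ℚ :+ (con (+ 1 ℚ./ 12) :+ δ :* con (+ 1 ℚ./ 2)) :- (con (+ 1 ℚ./ 12) :- δ :* con (+ 1 ℚ./ 2)) :+ J) :* q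
          := q :* (J :+ con (ℕ→ℚ 1)) :+ δ :* q) refl

open import Data.Nat using (_≤_)
open import Data.Nat.GCD using (gcd-identityˡ)
open import Data.Integer.GCD using (gcd)
open import Data.Rational using (_/_; _+_; _*_; _-_; -_; _<_)
open import Data.Rational.Solver using (module +-*-Solver)
open ParameterFractions using (α; α'; c; fraction-rep; α-fraction; β-fraction; γ-fraction)

pole-at-prime : ∀ p Q R m → Prime p → p ≡ Q ℕ.* suc m ℕ.+ R → 6 ≤ Q → 1 ≤ R →
  ∀ (k₀ : ℤ) (δ a b : ℚ) → δ * ℕ→ℚ Q ≡ ℕ→ℚ R → a ≡ α δ → b ≡ α' δ →
  let G = modFormSeries k₀ a (1ℚ + a - c) (1ℚ + a - b)
  in ∃ λ (i : ℕ) → G i ≢ 0ℚ × vpScaled p a (G i) ≡ - 1ℚ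
pole-at-prime p Q@(suc Q') R m p-prime p≡Qn+R 6≤Q 1≤R k₀ δ _ _ δQ≡R refl refl =
  suc m , simplePole≢0 pole , vpScaled-simplePole (α δ) _ p∤1728 pole
  where
  open LocalSeries p p-prime
  open PrimeInProgression p Q R m p-prime p≡Qn+R 6≤Q 1≤R
  A = α δ
  B = 1ℚ + α δ - c
  C = 1ℚ + α δ - α' δ
  unit-A : ∀ j → j ≤ m → Unit (A + ℕ→ℚ j)
  unit-A j j≤m = unit-via (fraction-rep (A + ℕ→ℚ j) (+ (Q ℕ.* (12 ℕ.* j ℕ.+ 1) ℕ.+ 6 ℕ.* R)) _ (α-fraction δ Q R δQ≡R j)) (p∤-numeratorA j j≤m) p∤12Q
  unit-B : ∀ j → j ≤ m → Unit (B + ℕ→ℚ j)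
  unit-B j j≤m = unit-via (fraction-rep (B + ℕ→ℚ j) (+ (Q ℕ.* (12 ℕ.* j ℕ.+ 5) ℕ.+ 6 ℕ.* R)) _ (β-fraction δ Q R δQ≡R j)) (p∤-numeratorB j j≤m) p∤12Q
  unit-C : ∀ j → j ℕ.< m → Unit (C + ℕ→ℚ j)
  unit-C j j<m = unit-via (fraction-rep (C + ℕ→ℚ j) (+ (Q ℕ.* (j ℕ.+ 1) ℕ.+ R)) Q' (γ-fraction δ Q R δQ≡R j)) (p∤-numeratorC j j<m) p∤Q
  -- C + m = p/Q
  zero-C : SimpleZero (C + ℕ→ℚ m)
  zero-C = simpleZero-via (fraction-rep (C + ℕ→ℚ m) (+ (Q ℕ.* (m ℕ.+ 1) ℕ.+ R)) Q' (γ-fraction δ Q R δQ≡R m)) 1 numeratorC-last p∤1 p∤Q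
  unit-1+j : ∀ j → j ≤ m → Unit (ℕ→ℚ (suc j))
  unit-1+j j j≤m = unit-fraction (+ suc j) 0 (p∤1+j j j≤m) p∤1
  integral-A : Integral A
  integral-A = subst Integral (ℚP.+-identityʳ A) (unit⇒integral (unit-A 0 z≤n))
  pole : SimplePole (modFormSeries k₀ A B C (suc m))
  pole = modFormSeries-simplePole m k₀ A B C n<p p∤1728 integral-A
    (λ j j<m → unitStep (unit-A j (ℕP.<⇒≤ j<m)) (unit-B j (ℕP.<⇒≤ j<m)) (unit-C j j<m) (unit-1+j j (ℕP.<⇒≤ j<m)))
    (poleStep (unit-A m ℕP.≤-refl) (unit-B m ℕP.≤-refl) zero-C (unit-1+j m ℕP.≤-refl))

fraction-*-den : ∀ R Q .{{_ : NonZero Q}} → (+ R / Q) * ℕ→ℚ Q ≡ ℕ→ℚ R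
fraction-*-den R (suc Q') = ℚP.toℚᵘ-injective (UP.≃-trans (ℚP.toℚᵘ-homo-* (+ R / suc Q') (ℕ→ℚ (suc Q')))
  (UP.≃-trans (UP.*-cong (ℚP.toℚᵘ-fromℚᵘ (U.mkℚᵘ (+ R) Q')) (ℚP.toℚᵘ-fromℚᵘ (U.mkℚᵘ (+ suc Q') 0)))
    (UP.≃-trans cancel (UP.≃-sym (ℚP.toℚᵘ-fromℚᵘ (U.mkℚᵘ (+ R) 0))))))
  where
  cancel : (U.mkℚᵘ (+ R) Q' U.* U.mkℚᵘ (+ suc Q') 0) U.≃ U.mkℚᵘ (+ R) 0
  cancel = U.*≡* (trans (ℤP.*-identityʳ _) (cong (λ t → + R ℤ.* + t) (sym (ℕP.*-identityʳ (suc Q')))))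

module _ where
  open +-*-Solver

  positive-difference : ∀ x y → 0ℚ < x - y → y < x
  positive-difference x y 0<x-y =
    subst₂ _<_ (ℚP.+-identityʳ y) (solve 2 (λ x y → y :+ (x :- y) := x) refl x y) (ℚP.+-monoʳ-< y 0<x-y)

  negative-difference : ∀ x y → x - y < 0ℚ → x < y
  negative-difference x y x-y<0 =
    subst₂ _<_ (solve 2 (λ x y → y :+ (x :- y) := x) refl x y) (ℚP.+-identityʳ y) (ℚP.+-monoʳ-< y x-y<0)

  -- the parameters a, b for δ = m₂ - m₁ are those for m₁ - m₂ with the roles exchanged
  α-neg : ∀ d → (+ 1 / 12) - d * (+ 1 / 2) ≡ α (- d)
  α-neg = solve 1 (λ d → con (+ 1 / 12) :- d :* con (+ 1 / 2) := con (+ 1 / 12) :+ (:- d) :* con (+ 1 / 2)) refl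

  α'-neg : ∀ d → (+ 1 / 12) + d * (+ 1 / 2) ≡ α' (- d)
  α'-neg = solve 1 (λ d → con (+ 1 / 12) :+ d :* con (+ 1 / 2) := con (+ 1 / 12) :- (:- d) :* con (+ 1 / 2)) refl

  negate-factor : ∀ d q r → d * q ≡ - r → (- d) * q ≡ r
  negate-factor d q r dq≡-r = begin
    (- d) * q ≡⟨ sym (ℚP.neg-distribˡ-* d q) ⟩
    - (d * q) ≡⟨ cong -_ dq≡-r ⟩
    - (- r)   ≡⟨ solve 1 (λ r → :- (:- r) := r) refl r ⟩
    r         ∎
    where open ≡-Reasoning

prime-equation : ∀ (p Q n R : ℕ) → + p ≡ + Q ℤ.* + n ℤ.+ + R → p ≡ Q ℕ.* n ℕ.+ R
prime-equation p Q n R eq = ℤP.+-injective (trans eq (cong (ℤ._+ + R) (sym (ℤP.pos-* Q n))))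

proposition2 : ∀ (m₁ m₂ : ℚ) (P : ℤ) (Q : ℕ) .{{_ : NonZero Q}} (k₀ : ℤ) →
    gcd P (+ Q) ≡ + 1 →
    6 ≤ Q →
    m₁ - m₂ ≡ P / Q →
    (+ 6 / 1) * (m₁ + m₂) - 1ℚ ≡ k₀ / 1 →
    let a = (+ 1 / 12) + (m₁ - m₂) * (+ 1 / 2)
        b = (+ 1 / 12) - (m₁ - m₂) * (+ 1 / 2)
        c = + 2 / 3
        G₁ = modFormSeries k₀ a (1ℚ + a - c) (1ℚ + a - b)
        G₂ = modFormSeries k₀ b (1ℚ + b - c) (1ℚ + b - a)
    in (m₂ < m₁ ×
         (∀ (p n : ℕ) → 1 ≤ n → Prime p → + p ≡ + Q ℤ.* + n ℤ.+ P →
           ∃ λ (i : ℕ) → G₁ i ≢ 0ℚ × vpScaled p a (G₁ i) ≡ - 1ℚ))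
       ⊎
       (m₁ < m₂ ×
         (∀ (p n : ℕ) → 1 ≤ n → Prime p → + p ≡ + Q ℤ.* + n ℤ.- P →
           ∃ λ (i : ℕ) → G₂ i ≢ 0ℚ × vpScaled p b (G₂ i) ≡ - 1ℚ))
-- P = 0 is impossible: gcd(0, Q) = Q ≥ 6
proposition2 m₁ m₂ (+ zero) Q k₀ gcd≡1 6≤Q _ _ =
  ⊥-elim (ℕP.<-irrefl (sym Q≡1) (ℕP.≤-trans (s≤s (s≤s z≤n)) 6≤Q))
  where
  Q≡1 : Q ≡ 1
  Q≡1 = trans (sym (gcd-identityˡ Q)) (ℤP.+-injective gcd≡1)
proposition2 m₁ m₂ (+ suc R') Q k₀ _ 6≤Q d≡R/Q _ =
  inj₁ (positive-difference m₁ m₂ (subst (0ℚ <_) (sym d≡R/Q) (ℚP.positive⁻¹ (+ suc R' / Q) {{ℚP.normalize-pos (suc R') Q}})) ,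
        λ { p (suc m) _ p-prime p≡ → pole-at-prime p Q (suc R') m p-prime (prime-equation p Q (suc m) (suc R') p≡)
                                        6≤Q (s≤s z≤n) k₀ (m₁ - m₂) _ _ dQ≡R refl refl })
  where
  dQ≡R : (m₁ - m₂) * ℕ→ℚ Q ≡ ℕ→ℚ (suc R')
  dQ≡R = trans (cong (_* ℕ→ℚ Q) d≡R/Q) (fraction-*-den (suc R') Q)
proposition2 m₁ m₂ -[1+ R' ] Q k₀ _ 6≤Q d≡-R/Q _ =
  inj₂ (negative-difference m₁ m₂ (subst (_< 0ℚ) (sym d≡-R/Q) (ℚP.negative⁻¹ (-[1+ R' ] / Q) {{ℚP.neg-pos {+ suc R' / Q} (ℚP.normalize-pos (suc R') Q)}})) ,
        λ { p (suc m) _ p-prime p≡ → pole-at-prime p Q (suc R') m p-prime (prime-equation p Q (suc m) (suc R') p≡)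
                                        6≤Q (s≤s z≤n) k₀ (- (m₁ - m₂)) _ _ δQ≡R (α-neg (m₁ - m₂)) (α'-neg (m₁ - m₂)) })
  where
  δQ≡R : (- (m₁ - m₂)) * ℕ→ℚ Q ≡ ℕ→ℚ (suc R')
  δQ≡R = negate-factor (m₁ - m₂) (ℕ→ℚ Q) (ℕ→ℚ (suc R'))
           (trans (cong (_* ℕ→ℚ Q) d≡-R/Q)
                  (trans (sym (ℚP.neg-distribˡ-* (+ suc R' / Q) (ℕ→ℚ Q))) (cong -_ (fraction-*-den (suc R') Q))))
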